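{- Let $\mathbb K$ be a field and, for $n\ge 0$, let $A_n$ be the alternating linear graph on $n+1$ vertices. Then for every $n\geq 1$: \[\mathrm{H}^*_\mu(A_n;\mathbb K)\cong\begin{cases}\mathrm{H}^*_\mu(A_{n-1};\mathbb K) & \text{if } n\equiv 0\pmod 3,\\ 0 & \text{if } n\equiv 1\pmod 3,\\ \mathrm{H}^{*-1}_\mu(A_{n-2};\mathbb K)&\text{if } n\equiv 2\pmod 3.\end{cases}\]
   Context: An oriented linear graph on $n$ vertices is a digraph with vertices $v_0,\dots,v_{n-1}$ such that for each $i=1,\dots,n-1$ exactly one of $(v_i,v_{i-1})$, $(v_{i-1},v_i)$ is an edge, and there are no other edges. It is alternating if every vertex is a source of all its incident edges or a target of all its incident edges (equivalently, consecutive edges have opposite orientations); $A_n$ denotes the alternating linear graph on $n+1$ vertices, unique up to reversing all orientations. A multipath of a digraph $G$ is a spanning subgraph each of whose connected components is a single vertex or a simple directed path. Multipath cohomology $\mathrm{H}^*_\mu(G;\mathbb K)$ is the cohomology of the complex whose degree $n$ part has basis $b_H$ for multipaths $H$ with $n$ edges, with $d b_H=\sum_e(-1)^{\epsilon(H,H\cup e)}b_{H\cup e}$ over edges $e\notin H$ with $H\cup e$ a multipath, $\epsilon(H,H\cup e)$ = number of edges of $H$ preceding $e$ in a fixed total order of $E(G)$. -}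

module Defs where

open import Level using (Level; _⊔_; Lift; lift) renaming (suc to lsuc)
open import Algebra.Bundles using (CommutativeRing)
import Algebra.Properties.CommutativeSemigroup as CSProps
open import Data.Nat using (ℕ; zero; suc)
open import Data.Nat.Properties using () renaming (_≟_ to _≟ℕ_)
open import Data.Bool using (Bool; true; false) renaming (_≟_ to _≟B_)
open import Data.Fin using (Fin; toℕ) renaming (zero to fz; suc to fs)
open import Data.Fin.Properties using (all?)
open import Data.Fin.Subset using (Subset; _∈_; ∣_∣; outside)
open import Data.Fin.Subset.Properties using (_∈?_)
open import Data.Vec using (_∷_; []; _[_]≔_)
open import Data.Nat.Base using (_%_)
open import Data.Product using (Σ; ∃; _×_; _,_; proj₁; proj₂)
open import Data.Unit.Polymorphic using (⊤; tt)
open import Relation.Nullary using (¬_; Dec; yes; no)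
open import Relation.Nullary.Decidable using (_→-dec_)
open import Relation.Binary.PropositionalEquality using (_≡_)

record Field (c ℓ : Level) : Set (lsuc (c ⊔ ℓ)) where
  field
    commutativeRing : CommutativeRing c ℓ
  open CommutativeRing commutativeRing public
  field
    1≉0     : ¬ (1# ≈ 0#)
    inverse : ∀ x → ¬ (x ≈ 0#) → ∃ λ y → (x * y) ≈ 1#

-- An oriented linear graph with n edges (on n+1 vertices v_0,...,v_n)
-- is given by an orientation of each edge: edge i (i : Fin n) joins
-- v_i and v_{i+1}; `true` means v_i → v_{i+1}, `false` means v_{i+1} → v_i.

Orientation : ℕ → Set
Orientation n = Fin n → Bool

even : ℕ → Bool
even zero          = true
even (suc zero)    = false
even (suc (suc m)) = even m

-- The alternating linear graph A_n on n+1 vertices (n edges):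
-- consecutive edges have opposite orientations.  (Unique up to reversing
-- all orientations; we fix the one whose first edge is v_0 → v_1.)
A : (n : ℕ) → Orientation n
A n i = even (toℕ i)

-- A spanning subgraph of a linear graph with n edges is
-- determined by its edge set, a subset of Fin n.  Its components are
-- single vertices or simple directed paths iff whenever two consecutive
-- edges i, i+1 both belong to it they are oriented the same way
-- (so that together they form a directed path through v_{i+1}).

Multipath : ∀ {n} → Orientation n → Subset n → Set
Multipath {n} o S =
  ∀ (i j : Fin n) → toℕ j ≡ suc (toℕ i) → i ∈ S → j ∈ S → o i ≡ o j

multipath? : ∀ {n} (o : Orientation n) (S : Subset n) → Dec (Multipath o S)
multipath? o S =
  all? λ i → all? λ j →
    (toℕ j ≟ℕ suc (toℕ i)) →-dec ((i ∈? S) →-dec ((j ∈? S) →-dec (o i ≟B o j)))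

pre : ∀ {n} → Subset n → Fin n → ℕ
pre (b ∷ S) fz     = 0
pre (true ∷ S) (fs e)  = suc (pre S e)
pre (false ∷ S) (fs e) = pre S e

module Complex {c ℓ} (K : Field c ℓ) where
  open Field K

  sgn : ℕ → Carrier
  sgn zero    = 1#
  sgn (suc m) = - sgn m

  ∑ : ∀ {n} → (Fin n → Carrier) → Carrier
  ∑ {zero}  f = 0#
  ∑ {suc n} f = f fz + ∑ (λ i → f (fs i))

  term : ∀ {p} {P : Set p} → Dec P → Carrier → Carrier
  term (yes _) x = x
  term (no _)  x = 0#

  -- Cochains: K-valued functions on edge sets; the coefficient of b_H
  -- is the value at H.  A cochain lies in degree k if it vanishes off the
  -- multipaths with exactly k edges.
  Cochain : ℕ → Set c
  Cochain n = Subset n → Carrier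

  InDeg : ∀ {n} → Orientation n → ℕ → Cochain n → Set ℓ
  InDeg o k f = ∀ S → ¬ (Multipath o S × ∣ S ∣ ≡ k) → f S ≈ 0#

  -- The differential  d b_H = Σ_e (-1)^{ε(H,H∪e)} b_{H∪e}, in coordinates:
  -- (d f)(H') = Σ_{e ∈ H'} (-1)^{#edges of H' before e} f(H' ∖ e)
  -- for H' a multipath, and 0 otherwise.
  d : ∀ {n} → Orientation n → Cochain n → Cochain n
  d o f S = term (multipath? o S)
              (∑ λ e → term (e ∈? S) (sgn (pre S e) * f (S [ e ]≔ outside)))

  Cocycle : ∀ {n} → Orientation n → ℕ → Cochain n → Set ℓ
  Cocycle o k f = InDeg o k f × (∀ S → d o f S ≈ 0#)

  -- f and g are cohomologous in degree k: f - g = d h with h in degree k-1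
  -- (in degree 0 there are no coboundaries).
  Cohomologous : ∀ {n} → Orientation n → ℕ → Cochain n → Cochain n → Set (c ⊔ ℓ)
  Cohomologous o zero    f g = Lift c (∀ S → f S ≈ g S)
  Cohomologous o (suc j) f g =
    Σ (Cochain _) λ h → InDeg o j h × (∀ S → f S ≈ (g S + d o h S))

  private
    open import Relation.Binary.Reasoning.Setoid setoid
    open CSProps +-commutativeSemigroup using (interchange)

    term-cong : ∀ {p} {P : Set p} (D : Dec P) {x y} → x ≈ y → term D x ≈ term D y
    term-cong (yes _) e = e
    term-cong (no _)  e = refl

    term-+ : ∀ {p} {P : Set p} (D : Dec P) x y → term D (x + y) ≈ (term D x + term D y)
    term-+ (yes _) x y = refl
    term-+ (no _)  x y = sym (+-identityˡ 0#)

    term-* : ∀ {p} {P : Set p} (D : Dec P) a x → term D (a * x) ≈ (a * term D x)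
    term-* (yes _) a x = refl
    term-* (no _)  a x = sym (zeroʳ a)

    term-0 : ∀ {p} {P : Set p} (D : Dec P) → term D 0# ≈ 0#
    term-0 (yes _) = refl
    term-0 (no _)  = refl

    ∑-cong : ∀ {n} {f g : Fin n → Carrier} → (∀ i → f i ≈ g i) → ∑ f ≈ ∑ g
    ∑-cong {zero}  e = refl
    ∑-cong {suc n} e = +-cong (e fz) (∑-cong (λ i → e (fs i)))

    ∑-+ : ∀ {n} (f g : Fin n → Carrier) → ∑ (λ i → f i + g i) ≈ (∑ f + ∑ g)
    ∑-+ {zero}  f g = sym (+-identityˡ 0#)
    ∑-+ {suc n} f g = trans (+-cong refl (∑-+ (λ i → f (fs i)) (λ i → g (fs i))))
                            (interchange _ _ _ _)

    ∑-* : ∀ {n} a (f : Fin n → Carrier) → ∑ (λ i → a * f i) ≈ (a * ∑ f)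
    ∑-* {zero}  a f = sym (zeroʳ a)
    ∑-* {suc n} a f = trans (+-cong refl (∑-* a (λ i → f (fs i)))) (sym (distribˡ a _ _))

    ∑-0 : ∀ {n} → ∑ {n} (λ _ → 0#) ≈ 0#
    ∑-0 {zero}  = refl
    ∑-0 {suc n} = trans (+-cong refl (∑-0 {n})) (+-identityˡ 0#)

    *-comm-left : ∀ s a x → (s * (a * x)) ≈ (a * (s * x))
    *-comm-left s a x = trans (sym (*-assoc s a x))
                        (trans (*-cong (*-comm s a) refl) (*-assoc a s x))

  d-+ : ∀ {n} (o : Orientation n) f g S → d o (λ T → f T + g T) S ≈ (d o f S + d o g S)
  d-+ {n} o f g S = trans (term-cong (multipath? o S)
                  (trans (∑-cong λ e → trans (term-cong (e ∈? S) (distribˡ _ _ _))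
                                             (term-+ (e ∈? S) _ _))
                         (∑-+ {n} _ _)))
                (term-+ (multipath? o S) _ _)

  d-* : ∀ {n} (o : Orientation n) a f S → d o (λ T → a * f T) S ≈ (a * d o f S)
  d-* {n} o a f S = trans (term-cong (multipath? o S)
                  (trans (∑-cong λ e → trans (term-cong (e ∈? S) (*-comm-left _ a _))
                                             (term-* (e ∈? S) a _))
                         (∑-* {n} a _)))
                (term-* (multipath? o S) a _)

  d-0 : ∀ {n} (o : Orientation n) S → d o (λ _ → 0#) S ≈ 0#
  d-0 {n} o S = trans (term-cong (multipath? o S)
                    (trans (∑-cong λ e → trans (term-cong (e ∈? S) (zeroʳ _)) (term-0 (e ∈? S)))
                           (∑-0 {n})))
                  (term-0 (multipath? o S))

-- K-vector spaces given by a carrier with an equivalence-type relation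
-- and the vector operations (only what is needed to speak of linear
-- isomorphisms).

record VS {c ℓ} (K : Field c ℓ) (a r : Level) : Set (c ⊔ lsuc (a ⊔ r)) where
  field
    V    : Set a
    _≋_  : V → V → Set r
    𝟎    : V
    _⊕_  : V → V → V
    _⊙_  : Field.Carrier K → V → V

record LinIso {c ℓ a r a′ r′} {K : Field c ℓ} (X : VS K a r) (Y : VS K a′ r′)
              : Set (c ⊔ a ⊔ r ⊔ a′ ⊔ r′) where
  private
    module X = VS X
    module Y = VS Y
  field
    to       : X.V → Y.V
    from     : Y.V → X.V
    to-cong  : ∀ {x y} → x X.≋ y → to x Y.≋ to y
    from-cong : ∀ {x y} → x Y.≋ y → from x X.≋ from y
    to-from  : ∀ y → to (from y) Y.≋ y
    from-to  : ∀ x → from (to x) X.≋ x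
    to-⊕     : ∀ x y → to (x X.⊕ y) Y.≋ (to x Y.⊕ to y)
    to-⊙     : ∀ a x → to (a X.⊙ x) Y.≋ (a Y.⊙ to x)

ZeroVS : ∀ {c ℓ} (K : Field c ℓ) (a r : Level) → VS K a r
ZeroVS K a r = record
  { V = ⊤ ; _≋_ = λ _ _ → ⊤ ; 𝟎 = tt ; _⊕_ = λ _ _ → tt ; _⊙_ = λ _ _ → tt }

Hμ : ∀ {c ℓ} (K : Field c ℓ) {n} → Orientation n → ℕ → VS K (c ⊔ ℓ) (c ⊔ ℓ)
Hμ K {n} o k = record
  { V   = Σ (Cochain n) (Cocycle o k)
  ; _≋_ = λ x y → Cohomologous o k (proj₁ x) (proj₁ y)
  ; 𝟎   = (λ _ → 0#) , (λ S _ → refl) , d-0 o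
  ; _⊕_ = λ x y →
      (λ S → proj₁ x S + proj₁ y S)
      , (λ S ¬p → trans (+-cong (proj₁ (proj₂ x) S ¬p) (proj₁ (proj₂ y) S ¬p))
                        (+-identityˡ 0#))
      , (λ S → trans (d-+ o (proj₁ x) (proj₁ y) S)
                     (trans (+-cong (proj₂ (proj₂ x) S) (proj₂ (proj₂ y) S))
                            (+-identityˡ 0#)))
  ; _⊙_ = λ a x →
      (λ S → a * proj₁ x S)
      , (λ S ¬p → trans (*-cong refl (proj₁ (proj₂ x) S ¬p)) (zeroʳ a))
      , (λ S → trans (d-* o a (proj₁ x) S)
                     (trans (*-cong refl (proj₂ (proj₂ x) S)) (zeroʳ a)))
  }
  where
    open Field K
    open Complex K

-- For the alternating graph, multipaths are exactly the edge sets without two consecutive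
-- edges, and d is the restriction to them of the coboundary δ of the full simplex on the edges.
-- Cut A_{m+2} after its first two edges, and let σ H and τ H add edge 1, resp. edge 0, to an edge
-- set H of the remaining graph A_{m-1}.  The maps π g = g ∘ σ - g ∘ τ and ι = extension by zero
-- along σ anticommute with d, π ∘ ι = id, and on cocycles ι ∘ π = id + d h with
-- (h g)(T) = - g(T ∪ {0}) for T avoiding edges 0 and 1.  Hence H^{k+1}(A_{m+2}) ≅ H^k(A_{m-1}),
-- where A_{-1}, the empty graph, has the complex of A_0.  Together with H^0(A_n) = 0 for n ≥ 1
-- and H^*(A_1) = 0, induction on n modulo 3 gives the three cases; for instance
-- H^{k+1}(A_{3q+3}) ≅ H^k(A_{3q}) ≅ H^{k+1}(A_{3q+2}).

module Submission where

open import Defs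
open import Level using (Level; _⊔_; lift) renaming (suc to lsuc)
open import Function using (_∘_)
open import Data.Bool using (Bool; true; false; not)
open import Data.Bool.Properties using (not-¬)
open import Data.Empty using (⊥; ⊥-elim)
open import Data.Fin using (Fin; toℕ) renaming (zero to fz; suc to fs)
open import Data.Fin.Subset using (Subset; _∈_; ∣_∣; outside; ⁅_⁆) renaming (⊥ to ∅)
open import Data.Fin.Subset.Properties using (_∈?_; x∈⁅y⁆⇒x≡y)
open import Data.Maybe using (Maybe; just; nothing; maybe′)
open import Data.Nat using (ℕ; zero; suc; _≤_; _∸_; _%_; _/_)
open import Data.Nat.DivMod using (m≡m%n+[m/n]*n)
open import Data.Nat.Properties using (suc-injective; 1+n≢n) renaming (_≟_ to _≟ℕ_)
open import Data.Product using (_×_; _,_; proj₁; proj₂)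
open import Data.Unit.Polymorphic using (tt)
open import Data.Vec using (_∷_; []; _[_]=_; _[_]≔_)
open _[_]=_
open import Relation.Binary.Bundles using (Setoid)
open import Relation.Binary.Structures using (IsEquivalence)
open import Relation.Binary.PropositionalEquality as ≡ using (_≡_; _≢_)
open import Relation.Nullary using (¬_; Dec; yes; no)

independent : ∀ {n} → Subset n → Bool
independent []                = true
independent (true ∷ true ∷ _) = false
independent (_ ∷ S)           = independent S

NoAdjacent : ∀ {n} → Subset n → Set
NoAdjacent {n} S = ∀ (i j : Fin n) → toℕ j ≡ suc (toℕ i) → i ∈ S → j ∈ S → ⊥

independent-∷ : ∀ {n} b (S : Subset n) → independent (b ∷ S) ≡ true → independent S ≡ true
independent-∷ false S           ind = ind
independent-∷ true  []          ind = ind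
independent-∷ true  (false ∷ S) ind = ind

NoAdjacent-∷ : ∀ {n} {b} {S : Subset n} → NoAdjacent (b ∷ S) → NoAdjacent S
NoAdjacent-∷ noAdj i j j≡1+i i∈S j∈S =
  noAdj (fs i) (fs j) (≡.cong suc j≡1+i) (there i∈S) (there j∈S)

independent⇒NoAdjacent : ∀ {n} (S : Subset n) → independent S ≡ true → NoAdjacent S
independent⇒NoAdjacent (true ∷ true ∷ S)  () fz (fs fz) _ here (there here)
independent⇒NoAdjacent (true ∷ false ∷ S) _  fz (fs fz) _ here (there ())
independent⇒NoAdjacent S       _   fz     fz          () _ _
independent⇒NoAdjacent S       _   fz     (fs (fs j)) () _ _
independent⇒NoAdjacent S       _   (fs i) fz          () _ _
independent⇒NoAdjacent (b ∷ S) ind (fs i) (fs j) j≡1+i (there i∈S) (there j∈S) =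
  independent⇒NoAdjacent S (independent-∷ b S ind) i j (suc-injective j≡1+i) i∈S j∈S

NoAdjacent⇒independent : ∀ {n} (S : Subset n) → NoAdjacent S → independent S ≡ true
NoAdjacent⇒independent []                 _     = ≡.refl
NoAdjacent⇒independent (true ∷ [])        _     = ≡.refl
NoAdjacent⇒independent (true ∷ true ∷ S)  noAdj = ⊥-elim (noAdj fz (fs fz) ≡.refl here (there here))
NoAdjacent⇒independent (true ∷ false ∷ S) noAdj =
  NoAdjacent⇒independent (false ∷ S) (NoAdjacent-∷ noAdj)
NoAdjacent⇒independent (false ∷ S)        noAdj = NoAdjacent⇒independent S (NoAdjacent-∷ noAdj)

even-suc : ∀ m → even (suc m) ≡ not (even m)
even-suc zero          = ≡.refl
even-suc (suc zero)    = ≡.refl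
even-suc (suc (suc m)) = even-suc m

A-alternating : ∀ {n} (i j : Fin n) → toℕ j ≡ suc (toℕ i) → A n i ≢ A n j
A-alternating i j j≡1+i Ai≡Aj =
  not-¬ ≡.refl (≡.trans Ai≡Aj (≡.trans (≡.cong even j≡1+i) (even-suc (toℕ i))))

false≢true : false ≢ true
false≢true ()

independent⇒multipath : ∀ {n} (o : Orientation n) S → independent S ≡ true → Multipath o S
independent⇒multipath o S ind i j j≡1+i i∈S j∈S =
  ⊥-elim (independent⇒NoAdjacent S ind i j j≡1+i i∈S j∈S)

multipath⇒independent : ∀ {n} {S : Subset n} → Multipath (A n) S → independent S ≡ true
multipath⇒independent {S = S} mp =
  NoAdjacent⇒independent S λ i j j≡1+i i∈S j∈S → A-alternating i j j≡1+i (mp i j j≡1+i i∈S j∈S)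

multipath-transfer : ∀ {m n} {S : Subset m} {T : Subset n} →
  independent S ≡ independent T → Multipath (A m) S → Multipath (A n) T
multipath-transfer {n = n} {T = T} S≡T mp =
  independent⇒multipath (A n) T (≡.trans (≡.sym S≡T) (multipath⇒independent mp))

singleton-multipath : ∀ {n} (o : Orientation n) e → Multipath o ⁅ e ⁆
singleton-multipath o e i j j≡1+i i∈⁅e⁆ j∈⁅e⁆
  rewrite x∈⁅y⁆⇒x≡y e i∈⁅e⁆ | x∈⁅y⁆⇒x≡y e j∈⁅e⁆ = ⊥-elim (1+n≢n (≡.sym j≡1+i))

∣S∣≡0⇒S≡∅ : ∀ {n} (S : Subset n) → ∣ S ∣ ≡ 0 → S ≡ ∅
∣S∣≡0⇒S≡∅ []          _     = ≡.refl
∣S∣≡0⇒S≡∅ (false ∷ S) ∣S∣≡0 = ≡.cong (false ∷_) (∣S∣≡0⇒S≡∅ S ∣S∣≡0)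

-- pad H places an edge set of A_{m-1} on the last m - 1 of m edges, leaving out the first one.
-- For m = 0 it is the identity: A_{-1} is the empty graph, whose complex is that of A_0.
pad : ∀ {m} → Subset (m ∸ 1) → Subset m
pad {zero}  H = H
pad {suc m} H = false ∷ H

unpad : ∀ {m} → Subset m → Maybe (Subset (m ∸ 1))
unpad []          = just []
unpad (false ∷ H) = just H
unpad (true ∷ _)  = nothing

unpad-pad : ∀ {m} (H : Subset (m ∸ 1)) → unpad (pad {m} H) ≡ just H
unpad-pad {zero}  [] = ≡.refl
unpad-pad {suc m} H  = ≡.refl

∣pad∣ : ∀ {m} (H : Subset (m ∸ 1)) → ∣ pad {m} H ∣ ≡ ∣ H ∣
∣pad∣ {zero}  H = ≡.refl
∣pad∣ {suc m} H = ≡.refl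

independent-pad : ∀ {m} (H : Subset (m ∸ 1)) → independent (pad {m} H) ≡ independent H
independent-pad {zero}  H = ≡.refl
independent-pad {suc m} H = ≡.refl

independent-true∷pad : ∀ {m} (H : Subset (m ∸ 1)) → independent (true ∷ pad {m} H) ≡ independent H
independent-true∷pad {zero}  [] = ≡.refl
independent-true∷pad {suc m} H  = ≡.refl

data PadView {m} : Subset m → Set where
  padded   : ∀ H → PadView (pad H)
  occupied : ∀ {T} → independent (true ∷ T) ≡ false → unpad T ≡ nothing → PadView T

padView : ∀ {m} (T : Subset m) → PadView T
padView []          = padded []
padView (false ∷ H) = padded H
padView (true ∷ T)  = occupied ≡.refl ≡.refl

module Cohomology {c ℓ} (K : Field c ℓ) where
  open Field K
  open Complex K
  open import Algebra.Properties.Ring ring using (-1*x≈-x; x[y-z]≈xy-xz; -‿distribˡ-*)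
  open import Algebra.Properties.AbelianGroup +-abelianGroup using (⁻¹-anti-homo‿-; ⁻¹-∙-comm)
  open import Algebra.Properties.Group +-group using (ε⁻¹≈ε; ⁻¹-involutive)
  open import Algebra.Properties.CommutativeSemigroup +-commutativeSemigroup using (interchange)
  open import Relation.Binary.Reasoning.Setoid setoid

  -0≈0 : - 0# ≈ 0#
  -0≈0 = ε⁻¹≈ε

  x-0≈x : ∀ x → x - 0# ≈ x
  x-0≈x x = trans (+-congˡ -0≈0) (+-identityʳ x)

  x+y-y≈x : ∀ x y → x + y - y ≈ x
  x+y-y≈x x y = trans (+-assoc x y (- y)) (trans (+-congˡ (-‿inverseʳ y)) (+-identityʳ x))

  -‿+-distrib : ∀ x y → - (x + y) ≈ - x + - y
  -‿+-distrib x y = sym (⁻¹-∙-comm x y)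

  +-‿-interchange : ∀ a b c′ d′ → (a + b) - (c′ + d′) ≈ (a - c′) + (b - d′)
  +-‿-interchange a b c′ d′ = trans (+-congˡ (-‿+-distrib c′ d′)) (interchange a b (- c′) (- d′))

  [a-y]-[a-x]≈x-y : ∀ a x y → (a - y) - (a - x) ≈ x - y
  [a-y]-[a-x]≈x-y a x y = begin
    (a - y) - (a - x)      ≈⟨ +-‿-interchange a (- y) a (- x) ⟩
    (a - a) + (- y - - x)  ≈⟨ +-cong (-‿inverseʳ a) (+-congˡ (⁻¹-involutive x)) ⟩
    0# + (- y + x)         ≈⟨ +-identityˡ _ ⟩
    - y + x                ≈⟨ +-comm (- y) x ⟩
    x - y                  ∎

  term-cong : ∀ {p} {P : Set p} (P? : Dec P) {x y} → x ≈ y → term P? x ≈ term P? y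
  term-cong (yes _) x≈y = x≈y
  term-cong (no _)  _   = refl

  ∑-cong : ∀ {n} {f g : Fin n → Carrier} → (∀ i → f i ≈ g i) → ∑ f ≈ ∑ g
  ∑-cong {zero}  _   = refl
  ∑-cong {suc n} f≈g = +-cong (f≈g fz) (∑-cong (f≈g ∘ fs))

  ∑-neg : ∀ {n} (f : Fin n → Carrier) → ∑ (λ i → - f i) ≈ - ∑ f
  ∑-neg {zero}  f = sym -0≈0
  ∑-neg {suc n} f = trans (+-congˡ (∑-neg (f ∘ fs))) (sym (-‿+-distrib _ _))

  -- The coboundary of the full simplex on the edges; d o is its restriction to the multipaths of o.
  δ : ∀ {n} → Cochain n → Cochain n
  δ f S = ∑ λ e → term (e ∈? S) (sgn (pre S e) * f (S [ e ]≔ outside))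

  d-multipath : ∀ {n} (o : Orientation n) f {S} → Multipath o S → d o f S ≈ δ f S
  d-multipath o f {S} mp with multipath? o S
  ... | yes _   = refl
  ... | no ¬mp  = ⊥-elim (¬mp mp)

  d-nonMultipath : ∀ {n} (o : Orientation n) f {S} → ¬ Multipath o S → d o f S ≈ 0#
  d-nonMultipath o f {S} ¬mp with multipath? o S
  ... | yes mp = ⊥-elim (¬mp mp)
  ... | no _   = refl

  δ-cong : ∀ {n} {f g : Cochain n} → (∀ S → f S ≈ g S) → ∀ S → δ f S ≈ δ g S
  δ-cong f≈g S = ∑-cong λ e → term-cong (e ∈? S) (*-congˡ (f≈g _))

  d-cong : ∀ {n} (o : Orientation n) {f g} → (∀ S → f S ≈ g S) → ∀ S → d o f S ≈ d o g S
  d-cong o f≈g S with multipath? o S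
  ... | yes _ = δ-cong f≈g S
  ... | no _  = refl

  δ-false∷ : ∀ {n} (f : Cochain (suc n)) S → δ f (false ∷ S) ≈ δ (λ T → f (false ∷ T)) S
  δ-false∷ f S = trans (+-identityˡ _) (∑-cong λ e → term-there e)
    where
    term-there : ∀ e {x} → term (fs e ∈? (false ∷ S)) x ≈ term (e ∈? S) x
    term-there e with e ∈? S
    ... | yes _ = refl
    ... | no _  = refl

  δ-true∷ : ∀ {n} (f : Cochain (suc n)) S → δ f (true ∷ S) ≈ f (false ∷ S) - δ (λ T → f (true ∷ T)) S
  δ-true∷ {n} f S = +-cong (*-identityˡ _) (trans (∑-cong λ e → term-there e) (∑-neg {n} _))
    where
    term-there : ∀ e {s x} → term (fs e ∈? (true ∷ S)) (- s * x) ≈ - term (e ∈? S) (s * x)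
    term-there e with e ∈? S
    ... | yes _ = sym (-‿distribˡ-* _ _)
    ... | no _  = sym -0≈0

  record IsLinear {m n} (F : Cochain m → Cochain n) : Set (c ⊔ ℓ) where
    field
      cong   : ∀ {f g} → (∀ S → f S ≈ g S) → ∀ S → F f S ≈ F g S
      +-homo : ∀ f g S → F (λ T → f T + g T) S ≈ F f S + F g S
      *-homo : ∀ a f S → F (λ T → a * f T) S ≈ a * F f S

    -‿homo : ∀ f S → F (λ T → - f T) S ≈ - F f S
    -‿homo f S = begin
      F (λ T → - f T) S      ≈⟨ cong (λ T → -1*x≈-x (f T)) S ⟨
      F (λ T → - 1# * f T) S ≈⟨ *-homo (- 1#) f S ⟩
      - 1# * F f S           ≈⟨ -1*x≈-x _ ⟩
      - F f S                ∎

    0-homo : ∀ S → F (λ _ → 0#) S ≈ 0#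
    0-homo S = begin
      F (λ _ → 0#) S      ≈⟨ cong (λ _ → zeroˡ 0#) S ⟨
      F (λ _ → 0# * 0#) S ≈⟨ *-homo 0# (λ _ → 0#) S ⟩
      0# * F (λ _ → 0#) S ≈⟨ zeroˡ _ ⟩
      0#                  ∎

    difference-homo : ∀ f g S → F (λ T → f T - g T) S ≈ F f S - F g S
    difference-homo f g S = trans (+-homo f (λ T → - g T) S) (+-congˡ (-‿homo g S))

  d-linear : ∀ {n} (o : Orientation n) → IsLinear (d o)
  d-linear o = record { cong = d-cong o ; +-homo = d-+ o ; *-homo = d-* o }

  -- Every edge set is a multipath of the coherently oriented path, so δ is one of the d o.
  δ-linear : ∀ {n} → IsLinear (δ {n})
  δ-linear = record
    { cong   = δ-cong
    ; +-homo = λ f g S → trans (sym (coherent (λ T → f T + g T) S))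
                           (trans (d-+ _ f g S) (+-cong (coherent f S) (coherent g S)))
    ; *-homo = λ a f S → trans (sym (coherent (λ T → a * f T) S))
                           (trans (d-* _ a f S) (*-congˡ (coherent f S)))
    }
    where
    coherent : ∀ f S → d (λ _ → true) f S ≈ δ f S
    coherent f S = d-multipath (λ _ → true) f (λ _ _ _ _ _ → ≡.refl)

  δ-∅ : ∀ {n} (f : Cochain n) → δ f ∅ ≈ 0#
  δ-∅ {zero}  f = refl
  δ-∅ {suc n} f = trans (δ-false∷ f ∅) (δ-∅ (λ T → f (false ∷ T)))

  d-A-independent : ∀ {n} (f : Cochain n) S → independent S ≡ true → d (A n) f S ≈ δ f S
  d-A-independent {n} f S ind = d-multipath (A n) f (independent⇒multipath (A n) S ind)

  d-A-dependent : ∀ {n} (f : Cochain n) S → independent S ≡ false → d (A n) f S ≈ 0#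
  d-A-dependent {n} f S dep =
    d-nonMultipath (A n) f λ mp → false≢true (≡.trans (≡.sym dep) (multipath⇒independent mp))

  d-A-vanishes : ∀ {n} (f : Cochain n) S → (independent S ≡ true → δ f S ≈ 0#) → d (A n) f S ≈ 0#
  d-A-vanishes f S δf≈0 with independent S in ind
  ... | true  = trans (d-A-independent f S ind) (δf≈0 ≡.refl)
  ... | false = d-A-dependent f S ind

  inDeg-+ : ∀ {n} {o : Orientation n} {k f g} → InDeg o k f → InDeg o k g → InDeg o k (λ S → f S + g S)
  inDeg-+ f-deg g-deg S off = trans (+-cong (f-deg S off) (g-deg S off)) (+-identityˡ 0#)

  inDeg-* : ∀ {n} {o : Orientation n} {k f} a → InDeg o k f → InDeg o k (λ S → a * f S)
  inDeg-* a f-deg S off = trans (*-congˡ (f-deg S off)) (zeroʳ a)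

  inDeg-neg : ∀ {n} {o : Orientation n} {k f} → InDeg o k f → InDeg o k (λ S → - f S)
  inDeg-neg f-deg S off = trans (-‿cong (f-deg S off)) -0≈0

  module _ {n} (o : Orientation n) where
    private
      d-neg : ∀ f S → d o (λ T → - f T) S ≈ - d o f S
      d-neg = IsLinear.-‿homo (d-linear o)

    pointwise⇒cohomologous : ∀ k {f g} → (∀ S → f S ≈ g S) → Cohomologous o k f g
    pointwise⇒cohomologous zero    f≈g = lift f≈g
    pointwise⇒cohomologous (suc k) f≈g =
      (λ _ → 0#) , (λ _ _ → refl) , λ S → trans (f≈g S) (sym (trans (+-congˡ (d-0 o S)) (+-identityʳ _)))

    cohomologous-sym : ∀ k {f g} → Cohomologous o k f g → Cohomologous o k g f
    cohomologous-sym zero    (lift f≈g) = lift λ S → sym (f≈g S)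
    cohomologous-sym (suc k) {f} {g} (h , h-deg , f≈g+dh) = (λ S → - h S) , inDeg-neg h-deg , λ S → begin
      g S                         ≈⟨ x+y-y≈x (g S) (d o h S) ⟨
      g S + d o h S - d o h S     ≈⟨ +-cong (f≈g+dh S) (d-neg h S) ⟨
      f S + d o (λ T → - h T) S   ∎

    cohomologous-trans : ∀ k {f g e} → Cohomologous o k f g → Cohomologous o k g e → Cohomologous o k f e
    cohomologous-trans zero    (lift f≈g) (lift g≈e) = lift λ S → trans (f≈g S) (g≈e S)
    cohomologous-trans (suc k) {f} {g} {e} (h₁ , h₁-deg , f≈g+dh₁) (h₂ , h₂-deg , g≈e+dh₂) =
      (λ S → h₂ S + h₁ S) , inDeg-+ h₂-deg h₁-deg , λ S → begin
        f S                               ≈⟨ f≈g+dh₁ S ⟩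
        g S + d o h₁ S                    ≈⟨ +-congʳ (g≈e+dh₂ S) ⟩
        e S + d o h₂ S + d o h₁ S         ≈⟨ +-assoc _ _ _ ⟩
        e S + (d o h₂ S + d o h₁ S)       ≈⟨ +-congˡ (d-+ o h₂ h₁ S) ⟨
        e S + d o (λ T → h₂ T + h₁ T) S   ∎

    cohomologous-+ : ∀ k {f f′ g g′} → Cohomologous o k f f′ → Cohomologous o k g g′ →
                     Cohomologous o k (λ S → f S + g S) (λ S → f′ S + g′ S)
    cohomologous-+ zero    (lift f≈f′) (lift g≈g′) = lift λ S → +-cong (f≈f′ S) (g≈g′ S)
    cohomologous-+ (suc k) {f} {f′} {g} {g′} (h₁ , h₁-deg , f≈f′+dh₁) (h₂ , h₂-deg , g≈g′+dh₂) =
      (λ S → h₁ S + h₂ S) , inDeg-+ h₁-deg h₂-deg , λ S → begin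
        f S + g S                                 ≈⟨ +-cong (f≈f′+dh₁ S) (g≈g′+dh₂ S) ⟩
        (f′ S + d o h₁ S) + (g′ S + d o h₂ S)     ≈⟨ interchange _ _ _ _ ⟩
        (f′ S + g′ S) + (d o h₁ S + d o h₂ S)     ≈⟨ +-congˡ (d-+ o h₁ h₂ S) ⟨
        (f′ S + g′ S) + d o (λ T → h₁ T + h₂ T) S ∎

    cohomologous-* : ∀ k a {f g} → Cohomologous o k f g → Cohomologous o k (λ S → a * f S) (λ S → a * g S)
    cohomologous-* zero    a (lift f≈g) = lift λ S → *-congˡ (f≈g S)
    cohomologous-* (suc k) a {f} {g} (h , h-deg , f≈g+dh) = (λ S → a * h S) , inDeg-* a h-deg , λ S → begin
      a * f S                         ≈⟨ *-congˡ (f≈g+dh S) ⟩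
      a * (g S + d o h S)             ≈⟨ distribˡ a _ _ ⟩
      a * g S + a * d o h S           ≈⟨ +-congˡ (d-* o a h S) ⟨
      a * g S + d o (λ T → a * h T) S ∎

  record IsCongruence {a r} (X : VS K a r) : Set (c ⊔ a ⊔ r) where
    open VS X
    field
      ≋-isEquivalence : IsEquivalence _≋_
      ⊕-cong : ∀ {x x′ y y′} → x ≋ x′ → y ≋ y′ → (x ⊕ y) ≋ (x′ ⊕ y′)
      ⊙-cong : ∀ a {x y} → x ≋ y → (a ⊙ x) ≋ (a ⊙ y)
    open IsEquivalence ≋-isEquivalence public

  record Space : Set (lsuc (c ⊔ ℓ)) where
    constructor space
    field
      vectorSpace  : VS K (c ⊔ ℓ) (c ⊔ ℓ)
      isCongruence : IsCongruence vectorSpace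
    open VS vectorSpace public
    open IsCongruence isCongruence public

  _≅_ : Space → Space → Set (c ⊔ ℓ)
  X ≅ Y = LinIso (Space.vectorSpace X) (Space.vectorSpace Y)

  ≅-refl : ∀ {X} → X ≅ X
  ≅-refl {X} = record
    { to = λ x → x ; from = λ x → x ; to-cong = λ e → e ; from-cong = λ e → e
    ; to-from = λ _ → X.refl ; from-to = λ _ → X.refl
    ; to-⊕ = λ _ _ → X.refl ; to-⊙ = λ _ _ → X.refl }
    where module X = Space X

  ≅-trans : ∀ {X Y Z} → X ≅ Y → Y ≅ Z → X ≅ Z
  ≅-trans {X} {Y} {Z} i j = record
    { to        = λ x → J.to (I.to x)
    ; from      = λ z → I.from (J.from z)
    ; to-cong   = λ e → J.to-cong (I.to-cong e)
    ; from-cong = λ e → I.from-cong (J.from-cong e)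
    ; to-from   = λ z → Z.trans (J.to-cong (I.to-from (J.from z))) (J.to-from z)
    ; from-to   = λ x → X.trans (I.from-cong (J.from-to (I.to x))) (I.from-to x)
    ; to-⊕      = λ x y → Z.trans (J.to-cong (I.to-⊕ x y)) (J.to-⊕ _ _)
    ; to-⊙      = λ a x → Z.trans (J.to-cong (I.to-⊙ a x)) (J.to-⊙ _ _)
    }
    where
    module I = LinIso i
    module J = LinIso j
    module X = Space X
    module Z = Space Z

  ≅-sym : ∀ {X Y} → X ≅ Y → Y ≅ X
  ≅-sym {X} {Y} i = record
    { to        = I.from
    ; from      = I.to
    ; to-cong   = I.from-cong
    ; from-cong = I.to-cong
    ; to-from   = I.from-to
    ; from-to   = I.to-from
    ; to-⊕      = λ y y′ → X.trans (I.from-cong (Y.trans (Y.⊕-cong (Y.sym (I.to-from y)) (Y.sym (I.to-from y′)))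
                                                         (Y.sym (I.to-⊕ _ _))))
                                   (I.from-to _)
    ; to-⊙      = λ a y → X.trans (I.from-cong (Y.trans (Y.⊙-cong a (Y.sym (I.to-from y))) (Y.sym (I.to-⊙ _ _))))
                                  (I.from-to _)
    }
    where
    module I = LinIso i
    module X = Space X
    module Y = Space Y

  ≅-isEquivalence : IsEquivalence _≅_
  ≅-isEquivalence = record
    { refl  = λ {X} → ≅-refl {X}
    ; sym   = λ {X} {Y} → ≅-sym {X} {Y}
    ; trans = λ {X} {Y} {Z} → ≅-trans {X} {Y} {Z} }

  ≅-setoid : Setoid (lsuc (c ⊔ ℓ)) (c ⊔ ℓ)
  ≅-setoid = record { isEquivalence = ≅-isEquivalence }

  𝟘 : Space
  𝟘 = space (ZeroVS K (c ⊔ ℓ) (c ⊔ ℓ)) (record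
    { ≋-isEquivalence = record { refl = tt ; sym = λ _ → tt ; trans = λ _ _ → tt }
    ; ⊕-cong = λ _ _ → tt ; ⊙-cong = λ _ _ → tt })

  trivial⇒≅𝟘 : ∀ X → (∀ x → Space._≋_ X x (Space.𝟎 X)) → X ≅ 𝟘
  trivial⇒≅𝟘 X x≋𝟎 = record
    { to = λ _ → tt ; from = λ _ → X.𝟎 ; to-cong = λ _ → tt ; from-cong = λ _ → X.refl
    ; to-from = λ _ → tt ; from-to = λ x → X.sym (x≋𝟎 x)
    ; to-⊕ = λ _ _ → tt ; to-⊙ = λ _ _ → tt }
    where module X = Space X

  Hμ-space : ∀ {n} → Orientation n → ℕ → Space
  Hμ-space o k = space (Hμ K o k) (record
    { ≋-isEquivalence = record
      { refl  = λ {x} → pointwise⇒cohomologous o k {proj₁ x} λ _ → refl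
      ; sym   = cohomologous-sym o k
      ; trans = cohomologous-trans o k }
    ; ⊕-cong = cohomologous-+ o k
    ; ⊙-cong = λ a → cohomologous-* o k a })

  cocycle⁰-vanishes : ∀ {n} (o : Orientation (suc n)) {f} → Cocycle o 0 f → ∀ S → f S ≈ 0#
  cocycle⁰-vanishes o {f} (f-deg , f-closed) S with ∣ S ∣ ≟ℕ 0
  ... | no  ∣S∣≢0 = f-deg S (∣S∣≢0 ∘ proj₂)
  ... | yes ∣S∣≡0 = ≡.subst (λ T → f T ≈ 0#) (≡.sym (∣S∣≡0⇒S≡∅ S ∣S∣≡0)) (begin
    f ∅                                        ≈⟨ x-0≈x (f ∅) ⟨
    f (false ∷ ∅) - 0#                          ≈⟨ +-congˡ (-‿cong (δ-∅ (λ T → f (true ∷ T)))) ⟨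
    f (false ∷ ∅) - δ (λ T → f (true ∷ T)) ∅   ≈⟨ δ-true∷ f ∅ ⟨
    δ f ⁅ fz ⁆                                 ≈⟨ d-multipath o f (singleton-multipath o fz) ⟨
    d o f ⁅ fz ⁆                               ≈⟨ f-closed ⁅ fz ⁆ ⟩
    0#                                         ∎)

  H⁰-trivial : ∀ {n} (o : Orientation (suc n)) → Hμ-space o 0 ≅ 𝟘
  H⁰-trivial o = trivial⇒≅𝟘 (Hμ-space o 0) λ (f , f-cocycle) → lift (cocycle⁰-vanishes o f-cocycle)

  one-edge-trivial : ∀ (o : Orientation 1) k → Hμ-space o (suc k) ≅ 𝟘
  one-edge-trivial o k =
    trivial⇒≅𝟘 (Hμ-space o (suc k)) λ (g , g-deg , _) → h g , h-deg g g-deg , g≈dh g g-deg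
    where
    ∅-multipath : Multipath o (false ∷ [])
    ∅-multipath = independent⇒multipath o (false ∷ []) ≡.refl

    h : Cochain 1 → Cochain 1
    h g (false ∷ []) = g (true ∷ [])
    h g (true ∷ [])  = 0#

    h-deg : ∀ g → InDeg o (suc k) g → InDeg o k (h g)
    h-deg g g-deg (true ∷ [])  _   = refl
    h-deg g g-deg (false ∷ []) off =
      g-deg (true ∷ []) λ (_ , 1≡1+k) → off (∅-multipath , suc-injective 1≡1+k)

    g≈dh : ∀ g → InDeg o (suc k) g → ∀ S → g S ≈ 0# + d o (h g) S
    g≈dh g g-deg (false ∷ []) = begin
      g (false ∷ [])            ≈⟨ g-deg (false ∷ []) (λ ()) ⟩
      0#                        ≈⟨ +-identityˡ 0# ⟨
      0# + 0#                   ≈⟨ +-congˡ (trans (d-multipath o (h g) ∅-multipath) (δ-∅ (h g))) ⟨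
      0# + d o (h g) (false ∷ []) ∎
    g≈dh g g-deg (true ∷ []) = begin
      g (true ∷ [])              ≈⟨ x-0≈x _ ⟨
      g (true ∷ []) - 0#         ≈⟨ δ-true∷ (h g) [] ⟨
      δ (h g) (true ∷ [])        ≈⟨ d-multipath o (h g) (singleton-multipath o fz) ⟨
      d o (h g) (true ∷ [])      ≈⟨ +-identityˡ _ ⟨
      0# + d o (h g) (true ∷ []) ∎

  module _ {m n} {o : Orientation m} {o′ : Orientation n} {F : Cochain m → Cochain n}
           (F-linear : IsLinear F) (d∘F : ∀ f S → d o′ (F f) S ≈ - F (d o f) S) where
    private
      module F = IsLinear F-linear

    anticommuting-closed : ∀ {f} → (∀ S → d o f S ≈ 0#) → ∀ S → d o′ (F f) S ≈ 0#
    anticommuting-closed {f} f-closed S = begin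
      d o′ (F f) S     ≈⟨ d∘F f S ⟩
      - F (d o f) S    ≈⟨ -‿cong (F.cong f-closed S) ⟩
      - F (λ _ → 0#) S ≈⟨ -‿cong (F.0-homo S) ⟩
      - 0#             ≈⟨ -0≈0 ⟩
      0#               ∎

    anticommuting-coboundary : ∀ {f g h} → (∀ S → f S ≈ g S + d o h S) →
                               ∀ S → F f S ≈ F g S + d o′ (λ T → - F h T) S
    anticommuting-coboundary {f} {g} {h} f≈g+dh S = begin
      F f S                          ≈⟨ F.cong f≈g+dh S ⟩
      F (λ T → g T + d o h T) S      ≈⟨ F.+-homo g (d o h) S ⟩
      F g S + F (d o h) S            ≈⟨ +-congˡ (⁻¹-involutive _) ⟨
      F g S + - - F (d o h) S        ≈⟨ +-congˡ (-‿cong (d∘F h S)) ⟨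
      F g S + - d o′ (F h) S         ≈⟨ +-congˡ (IsLinear.-‿homo (d-linear o′) (F h) S) ⟨
      F g S + d o′ (λ T → - F h T) S ∎

  -- π and ι shift degrees by ∓1, so they anticommute with d; ι ∘ π is the identity on
  -- cocycles up to the homotopy h.
  record ShiftEquivalence {m n} (o : Orientation m) (o′ : Orientation n) : Set (c ⊔ ℓ) where
    field
      π        : Cochain m → Cochain n
      ι        : Cochain n → Cochain m
      h        : Cochain m → Cochain m
      π-linear : IsLinear π
      ι-linear : IsLinear ι
      d∘π      : ∀ f S → d o′ (π f) S ≈ - π (d o f) S
      d∘ι      : ∀ f S → d o (ι f) S ≈ - ι (d o′ f) S
      π-inDeg  : ∀ j f → InDeg o (suc j) f → InDeg o′ j (π f)
      π-inDeg₀ : ∀ f → InDeg o 0 f → ∀ S → π f S ≈ 0#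
      ι-inDeg  : ∀ j f → InDeg o′ j f → InDeg o (suc j) (ι f)
      h-inDeg  : ∀ j f → InDeg o (suc j) f → InDeg o j (h f)
      π∘ι      : ∀ f S → π (ι f) S ≈ f S
      ι∘π      : ∀ f → (∀ S → d o f S ≈ 0#) → ∀ S → Multipath o S → ι (π f) S ≈ f S + δ (h f) S

    π-cohomologous : ∀ k {f g} → Cohomologous o (suc k) f g → Cohomologous o′ k (π f) (π g)
    π-cohomologous zero {f} {g} (h′ , h′-deg , f≈g+dh′) = lift λ S → begin
      π f S                           ≈⟨ anticommuting-coboundary π-linear d∘π f≈g+dh′ S ⟩
      π g S + d o′ (λ T → - π h′ T) S ≈⟨ +-congˡ (d-cong o′ (λ T → trans (-‿cong (π-inDeg₀ h′ h′-deg T)) -0≈0) S) ⟩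
      π g S + d o′ (λ _ → 0#) S       ≈⟨ +-congˡ (d-0 o′ S) ⟩
      π g S + 0#                      ≈⟨ +-identityʳ _ ⟩
      π g S                           ∎
    π-cohomologous (suc j) (h′ , h′-deg , f≈g+dh′) =
      (λ T → - π h′ T) , inDeg-neg (π-inDeg j h′ h′-deg) , anticommuting-coboundary π-linear d∘π f≈g+dh′

    ι-cohomologous : ∀ k {f g} → Cohomologous o′ k f g → Cohomologous o (suc k) (ι f) (ι g)
    ι-cohomologous zero    (lift f≈g) = pointwise⇒cohomologous o 1 (IsLinear.cong ι-linear f≈g)
    ι-cohomologous (suc j) (h′ , h′-deg , f≈g+dh′) =
      (λ T → - ι h′ T) , inDeg-neg (ι-inDeg j h′ h′-deg) , anticommuting-coboundary ι-linear d∘ι f≈g+dh′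

    -- Off the multipaths of o, d o (h f) S is 0 by definition and the other two terms vanish
    -- for degree reasons.
    ι∘π-cohomologous : ∀ k {f} → Cocycle o (suc k) f → ∀ S → ι (π f) S ≈ f S + d o (h f) S
    ι∘π-cohomologous k {f} (f-deg , f-closed) S with multipath? o S
    ... | yes mp  = ι∘π f f-closed S mp
    ... | no  ¬mp = begin
      ι (π f) S ≈⟨ ι-inDeg k (π f) (π-inDeg k f f-deg) S (¬mp ∘ proj₁) ⟩
      0#        ≈⟨ +-identityʳ 0# ⟨
      0# + 0#   ≈⟨ +-congʳ (f-deg S (¬mp ∘ proj₁)) ⟨
      f S + 0#  ∎

    iso : ∀ k → Hμ-space o (suc k) ≅ Hμ-space o′ k
    iso k = record
      { to        = λ (f , f-deg , f-closed) →
                      π f , π-inDeg k f f-deg , anticommuting-closed π-linear d∘π f-closed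
      ; from      = λ (f , f-deg , f-closed) →
                      ι f , ι-inDeg k f f-deg , anticommuting-closed ι-linear d∘ι f-closed
      ; to-cong   = π-cohomologous k
      ; from-cong = ι-cohomologous k
      ; to-from   = λ (f , _) → pointwise⇒cohomologous o′ k (π∘ι f)
      ; from-to   = λ (f , f-cocycle) → h f , h-inDeg k f (proj₁ f-cocycle) , ι∘π-cohomologous k f-cocycle
      ; to-⊕      = λ (f , _) (g , _) → pointwise⇒cohomologous o′ k (IsLinear.+-homo π-linear f g)
      ; to-⊙      = λ a (f , _) → pointwise⇒cohomologous o′ k (IsLinear.*-homo π-linear a f)
      }

  inDeg-transfer : ∀ {m n k k′} {f : Cochain m} → InDeg (A m) k f → ∀ S (T : Subset n) →
    independent S ≡ independent T → (∣ S ∣ ≡ k → ∣ T ∣ ≡ k′) → ¬ (Multipath (A n) T × ∣ T ∣ ≡ k′) →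
    f S ≈ 0#
  inDeg-transfer f-deg S T S≡T size off =
    f-deg S λ (mp , ∣S∣≡k) → off (multipath-transfer S≡T mp , size ∣S∣≡k)

  δ-pad : ∀ {m} (f : Cochain m) H → δ f (pad H) ≈ δ (λ T → f (pad T)) H
  δ-pad {zero}  f H = refl
  δ-pad {suc m} f H = δ-false∷ f H

  module Shift (m : ℕ) where
    σ τ : Subset (m ∸ 1) → Subset (suc (suc m))
    σ H = false ∷ true ∷ pad H
    τ H = true ∷ false ∷ pad H

    ρ : Subset (suc (suc m)) → Maybe (Subset (m ∸ 1))
    ρ (false ∷ true ∷ T) = unpad T
    ρ _                  = nothing

    π : Cochain (suc (suc m)) → Cochain (m ∸ 1)
    π f H = f (σ H) - f (τ H)

    ι : Cochain (m ∸ 1) → Cochain (suc (suc m))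
    ι f S = maybe′ f 0# (ρ S)

    h : Cochain (suc (suc m)) → Cochain (suc (suc m))
    h f (false ∷ false ∷ T) = - f (true ∷ false ∷ T)
    h f _                   = 0#

    independent-σ : ∀ H → independent (σ H) ≡ independent H
    independent-σ = independent-true∷pad {m}

    independent-τ : ∀ H → independent (τ H) ≡ independent H
    independent-τ = independent-pad {m}

    ι-σ : ∀ f H → ι f (σ H) ≈ f H
    ι-σ f H = reflexive (≡.cong (maybe′ f 0#) (unpad-pad {m} H))

    δ-σ : ∀ f H → δ f (σ H) ≈ f (false ∷ false ∷ pad H) - δ (λ T → f (σ T)) H
    δ-σ f H = begin
      δ f (σ H)
        ≈⟨ δ-false∷ f (true ∷ pad H) ⟩
      δ (λ T → f (false ∷ T)) (true ∷ pad H)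
        ≈⟨ δ-true∷ (λ T → f (false ∷ T)) (pad H) ⟩
      f (false ∷ false ∷ pad H) - δ (λ T → f (false ∷ true ∷ T)) (pad H)
        ≈⟨ +-congˡ (-‿cong (δ-pad (λ T → f (false ∷ true ∷ T)) H)) ⟩
      f (false ∷ false ∷ pad H) - δ (λ T → f (σ T)) H
        ∎

    δ-τ : ∀ f H → δ f (τ H) ≈ f (false ∷ false ∷ pad H) - δ (λ T → f (τ T)) H
    δ-τ f H = begin
      δ f (τ H)
        ≈⟨ δ-true∷ f (false ∷ pad H) ⟩
      f (false ∷ false ∷ pad H) - δ (λ T → f (true ∷ T)) (false ∷ pad H)
        ≈⟨ +-congˡ (-‿cong (δ-false∷ (λ T → f (true ∷ T)) (pad H))) ⟩
      f (false ∷ false ∷ pad H) - δ (λ T → f (true ∷ false ∷ T)) (pad H)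
        ≈⟨ +-congˡ (-‿cong (δ-pad (λ T → f (true ∷ false ∷ T)) H)) ⟩
      f (false ∷ false ∷ pad H) - δ (λ T → f (τ T)) H
        ∎

    π-linear : IsLinear π
    π-linear = record
      { cong   = λ f≈g H → +-cong (f≈g _) (-‿cong (f≈g _))
      ; +-homo = λ f g H → +-‿-interchange _ _ _ _
      ; *-homo = λ a f H → sym (x[y-z]≈xy-xz a _ _)
      }

    ι-linear : IsLinear ι
    ι-linear = record { cong = ι-cong ; +-homo = ι-+ ; *-homo = ι-* }
      where
      ι-cong : ∀ {f g} → (∀ H → f H ≈ g H) → ∀ S → ι f S ≈ ι g S
      ι-cong f≈g S with ρ S
      ... | just H  = f≈g H
      ... | nothing = refl

      ι-+ : ∀ f g S → ι (λ H → f H + g H) S ≈ ι f S + ι g S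
      ι-+ f g S with ρ S
      ... | just H  = refl
      ... | nothing = sym (+-identityˡ 0#)

      ι-* : ∀ a f S → ι (λ H → a * f H) S ≈ a * ι f S
      ι-* a f S with ρ S
      ... | just H  = refl
      ... | nothing = sym (zeroʳ a)

    d∘π : ∀ f H → d (A (m ∸ 1)) (π f) H ≈ - π (d (A (suc (suc m))) f) H
    d∘π f H with independent H in ind
    ... | true = begin
      d (A _) (π f) H                     ≈⟨ d-A-independent (π f) H ind ⟩
      δ (π f) H                           ≈⟨ IsLinear.difference-homo δ-linear fσ fτ H ⟩
      δ fσ H - δ fτ H                     ≈⟨ ⁻¹-anti-homo‿- _ _ ⟨
      - (δ fτ H - δ fσ H)                 ≈⟨ -‿cong ([a-y]-[a-x]≈x-y f₀₀ _ _) ⟨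
      - ((f₀₀ - δ fσ H) - (f₀₀ - δ fτ H)) ≈⟨ -‿cong (+-cong (δ-σ f H) (-‿cong (δ-τ f H))) ⟨
      - (δ f (σ H) - δ f (τ H))           ≈⟨ -‿cong (+-cong (d-A-independent f (σ H) σ-ind)
                                                            (-‿cong (d-A-independent f (τ H) τ-ind))) ⟨
      - π (d (A _) f) H                   ∎
      where
      fσ fτ : Cochain (m ∸ 1)
      fσ T = f (σ T)
      fτ T = f (τ T)
      f₀₀ = f (false ∷ false ∷ pad H)
      σ-ind = ≡.trans (independent-σ H) ind
      τ-ind = ≡.trans (independent-τ H) ind
    ... | false = begin
      d (A _) (π f) H   ≈⟨ d-A-dependent (π f) H ind ⟩
      0#                ≈⟨ -0≈0 ⟨
      - 0#              ≈⟨ -‿cong (x-0≈x 0#) ⟨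
      - (0# - 0#)       ≈⟨ -‿cong (+-cong (d-A-dependent f (σ H) σ-dep) (-‿cong (d-A-dependent f (τ H) τ-dep))) ⟨
      - π (d (A _) f) H ∎
      where
      σ-dep = ≡.trans (independent-σ H) ind
      τ-dep = ≡.trans (independent-τ H) ind

    d∘ι-σ : ∀ f H → d (A (suc (suc m))) (ι f) (σ H) ≈ - ι (d (A (m ∸ 1)) f) (σ H)
    d∘ι-σ f H with independent H in ind
    ... | true = begin
      d (A _) (ι f) (σ H)           ≈⟨ d-A-independent (ι f) (σ H) (≡.trans (independent-σ H) ind) ⟩
      δ (ι f) (σ H)                 ≈⟨ δ-σ (ι f) H ⟩
      0# - δ (λ T → ι f (σ T)) H    ≈⟨ +-identityˡ _ ⟩
      - δ (λ T → ι f (σ T)) H       ≈⟨ -‿cong (δ-cong (ι-σ f) H) ⟩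
      - δ f H                       ≈⟨ -‿cong (d-A-independent f H ind) ⟨
      - d (A _) f H                 ≈⟨ -‿cong (ι-σ (d (A _) f) H) ⟨
      - ι (d (A _) f) (σ H)         ∎
    ... | false = begin
      d (A _) (ι f) (σ H)           ≈⟨ d-A-dependent (ι f) (σ H) (≡.trans (independent-σ H) ind) ⟩
      0#                            ≈⟨ -0≈0 ⟨
      - 0#                          ≈⟨ -‿cong (d-A-dependent f H ind) ⟨
      - d (A _) f H                 ≈⟨ -‿cong (ι-σ (d (A _) f) H) ⟨
      - ι (d (A _) f) (σ H)         ∎

    d∘ι : ∀ f S → d (A (suc (suc m))) (ι f) S ≈ - ι (d (A (m ∸ 1)) f) S
    d∘ι f S@(true ∷ true ∷ _) = begin
      d (A _) (ι f) S ≈⟨ d-A-dependent (ι f) S ≡.refl ⟩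
      0#              ≈⟨ -0≈0 ⟨
      - 0#            ∎
    d∘ι f S@(true ∷ false ∷ T) = begin
      d (A _) (ι f) S ≈⟨ d-A-vanishes (ι f) S (λ _ → δι≈0) ⟩
      0#              ≈⟨ -0≈0 ⟨
      - 0#            ∎
      where
      δι≈0 : δ (ι f) S ≈ 0#
      δι≈0 = begin
        δ (ι f) S                     ≈⟨ δ-true∷ (ι f) (false ∷ T) ⟩
        0# - δ (λ _ → 0#) (false ∷ T) ≈⟨ +-congˡ (-‿cong (IsLinear.0-homo δ-linear (false ∷ T))) ⟩
        0# - 0#                       ≈⟨ x-0≈x 0# ⟩
        0#                            ∎
    d∘ι f S@(false ∷ false ∷ T) = begin
      d (A _) (ι f) S ≈⟨ d-A-vanishes (ι f) S (λ _ → trans (δ-false∷ (ι f) (false ∷ T))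
                                                           (IsLinear.0-homo δ-linear (false ∷ T))) ⟩
      0#              ≈⟨ -0≈0 ⟨
      - 0#            ∎
    d∘ι f (false ∷ true ∷ T) with padView T
    ... | padded H = d∘ι-σ f H
    ... | occupied dependent unpad≡nothing = begin
      d (A _) (ι f) (false ∷ true ∷ T)  ≈⟨ d-A-dependent (ι f) (false ∷ true ∷ T) dependent ⟩
      0#                                ≈⟨ -0≈0 ⟨
      - 0#                              ≈⟨ -‿cong (reflexive (≡.cong (maybe′ (d (A _) f) 0#) unpad≡nothing)) ⟨
      - ι (d (A _) f) (false ∷ true ∷ T) ∎

    π-inDeg : ∀ j f → InDeg (A (suc (suc m))) (suc j) f → InDeg (A (m ∸ 1)) j (π f)
    π-inDeg j f f-deg H off = begin
      f (σ H) - f (τ H) ≈⟨ +-cong (inDeg-transfer f-deg (σ H) H (independent-σ H) shrink off)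
                                  (-‿cong (inDeg-transfer f-deg (τ H) H (independent-τ H) shrink off)) ⟩
      0# - 0#           ≈⟨ x-0≈x 0# ⟩
      0#                ∎
      where
      shrink : suc ∣ pad {m} H ∣ ≡ suc j → ∣ H ∣ ≡ j
      shrink e = ≡.trans (≡.sym (∣pad∣ {m} H)) (suc-injective e)

    π-inDeg₀ : ∀ f → InDeg (A (suc (suc m))) 0 f → ∀ H → π f H ≈ 0#
    π-inDeg₀ f f-deg H = begin
      f (σ H) - f (τ H) ≈⟨ +-cong (f-deg (σ H) λ ()) (-‿cong (f-deg (τ H) λ ())) ⟩
      0# - 0#           ≈⟨ x-0≈x 0# ⟩
      0#                ∎

    ι-inDeg : ∀ j f → InDeg (A (m ∸ 1)) j f → InDeg (A (suc (suc m))) (suc j) (ι f)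
    ι-inDeg j f f-deg (true ∷ _)          _ = refl
    ι-inDeg j f f-deg (false ∷ false ∷ _) _ = refl
    ι-inDeg j f f-deg (false ∷ true ∷ T) off with padView T
    ... | padded H = trans (ι-σ f H) (inDeg-transfer f-deg H (σ H) (≡.sym (independent-σ H)) grow off)
      where
      grow : ∣ H ∣ ≡ j → suc ∣ pad {m} H ∣ ≡ suc j
      grow e = ≡.cong suc (≡.trans (∣pad∣ {m} H) e)
    ... | occupied _ unpad≡nothing = reflexive (≡.cong (maybe′ f 0#) unpad≡nothing)

    h-inDeg : ∀ j f → InDeg (A (suc (suc m))) (suc j) f → InDeg (A (suc (suc m))) j (h f)
    h-inDeg j f f-deg (true ∷ _)          _   = refl
    h-inDeg j f f-deg (false ∷ true ∷ _)  _   = refl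
    h-inDeg j f f-deg (false ∷ false ∷ T) off =
      trans (-‿cong (inDeg-transfer f-deg (true ∷ false ∷ T) (false ∷ false ∷ T) ≡.refl suc-injective off)) -0≈0

    π∘ι : ∀ f H → π (ι f) H ≈ f H
    π∘ι f H = trans (x-0≈x _) (ι-σ f H)

    homotopy-σ : ∀ f H → ι (π f) (σ H) ≈ f (σ H) + δ (h f) (σ H)
    homotopy-σ f H = begin
      ι (π f) (σ H)                          ≈⟨ ι-σ (π f) H ⟩
      f (σ H) - f (τ H)                      ≈⟨ +-congˡ (x-0≈x _) ⟨
      f (σ H) + (- f (τ H) - 0#)             ≈⟨ +-congˡ (+-congˡ (-‿cong (IsLinear.0-homo δ-linear H))) ⟨
      f (σ H) + (- f (τ H) - δ (λ _ → 0#) H) ≈⟨ +-congˡ (δ-σ (h f) H) ⟨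
      f (σ H) + δ (h f) (σ H)                ∎

    homotopy : ∀ f → (∀ S → d (A (suc (suc m))) f S ≈ 0#) → ∀ S → independent S ≡ true →
               ι (π f) S ≈ f S + δ (h f) S
    homotopy f f-closed S@(true ∷ false ∷ T) _ = begin
      0#                                       ≈⟨ -‿inverseʳ (f S) ⟨
      f S - f S                                ≈⟨ +-congˡ (x-0≈x _) ⟨
      f S + (- f S - 0#)                       ≈⟨ +-congˡ (+-congˡ (-‿cong (IsLinear.0-homo δ-linear (false ∷ T)))) ⟨
      f S + (- f S - δ (λ _ → 0#) (false ∷ T)) ≈⟨ +-congˡ (δ-true∷ (h f) (false ∷ T)) ⟨
      f S + δ (h f) S                          ∎
    homotopy f f-closed S@(false ∷ false ∷ T) ind = begin
      0#                                       ≈⟨ f-closed (true ∷ false ∷ T) ⟨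
      d (A _) f (true ∷ false ∷ T)             ≈⟨ d-A-independent f (true ∷ false ∷ T) ind ⟩
      δ f (true ∷ false ∷ T)                   ≈⟨ δ-true∷ f (false ∷ T) ⟩
      f S - δ (λ U → f (true ∷ U)) (false ∷ T) ≈⟨ +-congˡ (-‿cong (δ-false∷ (λ U → f (true ∷ U)) T)) ⟩
      f S - δ f₁₀ T                            ≈⟨ +-congˡ (IsLinear.-‿homo δ-linear f₁₀ T) ⟨
      f S + δ (λ U → - f₁₀ U) T                ≈⟨ +-congˡ δhf≈-δf₁₀ ⟨
      f S + δ (h f) S                          ∎
      where
      f₁₀ : Cochain m
      f₁₀ U = f (true ∷ false ∷ U)

      δhf≈-δf₁₀ : δ (h f) S ≈ δ (λ U → - f₁₀ U) T
      δhf≈-δf₁₀ = trans (δ-false∷ (h f) (false ∷ T)) (δ-false∷ (λ U → h f (false ∷ U)) T)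
    homotopy f f-closed (false ∷ true ∷ T) ind with padView T
    ... | padded H = homotopy-σ f H
    ... | occupied dependent _ = ⊥-elim (false≢true (≡.trans (≡.sym dependent) ind))

    equivalence : ShiftEquivalence (A (suc (suc m))) (A (m ∸ 1))
    equivalence = record
      { π = π ; ι = ι ; h = h ; π-linear = π-linear ; ι-linear = ι-linear ; d∘π = d∘π ; d∘ι = d∘ι
      ; π-inDeg = π-inDeg ; π-inDeg₀ = π-inDeg₀ ; ι-inDeg = ι-inDeg ; h-inDeg = h-inDeg ; π∘ι = π∘ι
      ; ι∘π = λ f f-closed S mp → homotopy f f-closed S (multipath⇒independent mp)
      }

  -- H is opaque so that Agda compares cohomology spaces by their indices instead of unfolding them.
  opaque
    H : ℕ → ℕ → Space
    H n = Hμ-space (A n)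

  opaque
    unfolding H

    H⁰-A-trivial : ∀ n → H (suc n) 0 ≅ 𝟘
    H⁰-A-trivial n = H⁰-trivial (A (suc n))

    H-A₁-trivial : ∀ k → H 1 (suc k) ≅ 𝟘
    H-A₁-trivial = one-edge-trivial (A 1)

    shift : ∀ m k → H (suc (suc m)) (suc k) ≅ H (m ∸ 1) k
    shift m = ShiftEquivalence.iso (Shift.equivalence m)

module Residues {c ℓ} (K : Field c ℓ) where
  open Cohomology K
  open import Data.Nat using (_+_; _*_)
  open import Relation.Binary.Reasoning.Setoid ≅-setoid

  residue1 : ∀ q k → H (1 + q * 3) k ≅ 𝟘
  residue1 q       zero    = H⁰-A-trivial (q * 3)
  residue1 zero    (suc k) = H-A₁-trivial k
  residue1 (suc q) (suc k) = begin
    H (4 + q * 3) (suc k) ≈⟨ shift (2 + q * 3) k ⟩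
    H (1 + q * 3) k       ≈⟨ residue1 q k ⟩
    𝟘                     ∎

  residue2 : ∀ q k → H (2 + q * 3) (suc k) ≅ H (q * 3) k
  residue2 zero    k       = shift 0 k
  residue2 (suc q) zero    = begin
    H (5 + q * 3) 1 ≈⟨ shift (3 + q * 3) 0 ⟩
    H (2 + q * 3) 0 ≈⟨ H⁰-A-trivial (1 + q * 3) ⟩
    𝟘               ≈⟨ H⁰-A-trivial (2 + q * 3) ⟨
    H (3 + q * 3) 0 ∎
  residue2 (suc q) (suc k) = begin
    H (5 + q * 3) (suc (suc k)) ≈⟨ shift (3 + q * 3) (suc k) ⟩
    H (2 + q * 3) (suc k)       ≈⟨ residue2 q k ⟩
    H (q * 3) k                 ≈⟨ shift (1 + q * 3) k ⟨
    H (3 + q * 3) (suc k)       ∎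

  residue0 : ∀ q k → H (3 + q * 3) k ≅ H (2 + q * 3) k
  residue0 q zero    = begin
    H (3 + q * 3) 0 ≈⟨ H⁰-A-trivial (2 + q * 3) ⟩
    𝟘               ≈⟨ H⁰-A-trivial (1 + q * 3) ⟨
    H (2 + q * 3) 0 ∎
  residue0 q (suc k) = begin
    H (3 + q * 3) (suc k) ≈⟨ shift (1 + q * 3) k ⟩
    H (q * 3) k           ≈⟨ residue2 q k ⟨
    H (2 + q * 3) (suc k) ∎

  by-residue : ∀ {p} (P : ℕ → Set p) r → (∀ q → P (r + q * 3)) → ∀ n → n % 3 ≡ r → P n
  by-residue P r P[r+3q] n n%3≡r =
    ≡.subst P (≡.sym (≡.trans (m≡m%n+[m/n]*n n 3) (≡.cong (_+ n / 3 * 3) n%3≡r))) (P[r+3q] (n / 3))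

  n≡0-mod-3 : ∀ n → n % 3 ≡ 0 → 1 ≤ n → ∀ k → H n k ≅ H (n ∸ 1) k
  n≡0-mod-3 = by-residue (λ n → 1 ≤ n → ∀ k → H n k ≅ H (n ∸ 1) k) 0 λ { zero () ; (suc q) _ → residue0 q }

  n≡1-mod-3 : ∀ n → n % 3 ≡ 1 → ∀ k → H n k ≅ 𝟘
  n≡1-mod-3 = by-residue (λ n → ∀ k → H n k ≅ 𝟘) 1 residue1

  n≡2-mod-3 : ∀ n → n % 3 ≡ 2 → H n 0 ≅ 𝟘 × (∀ k → H n (suc k) ≅ H (n ∸ 2) k)
  n≡2-mod-3 = by-residue (λ n → H n 0 ≅ 𝟘 × (∀ k → H n (suc k) ≅ H (n ∸ 2) k)) 2
    λ q → H⁰-A-trivial (1 + q * 3) , residue2 q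

opaque
  unfolding Cohomology.H

  theorem5p6 : ∀ {c ℓ : Level} (K : Field c ℓ) (n : ℕ) → 1 ≤ n →
    ((n % 3 ≡ 0) → ∀ k → LinIso (Hμ K (A n) k) (Hμ K (A (n ∸ 1)) k))
    × ((n % 3 ≡ 1) → ∀ k → LinIso (Hμ K (A n) k) (ZeroVS K (c ⊔ ℓ) (c ⊔ ℓ)))
    × ((n % 3 ≡ 2) →
         LinIso (Hμ K (A n) 0) (ZeroVS K (c ⊔ ℓ) (c ⊔ ℓ))
         × (∀ k → LinIso (Hμ K (A n) (suc k)) (Hμ K (A (n ∸ 2)) k)))
  theorem5p6 K n 1≤n = (λ n%3≡0 → n≡0-mod-3 n n%3≡0 1≤n) , n≡1-mod-3 n , n≡2-mod-3 n
    where open Residues K
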